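{- Let $G$ be a finite abelian group of order $n\ge 2$. If $G$ is isomorphic to an elementary abelian $2$-group, then $s(G,2)=0$. Otherwise $$\frac{1}{4}n \le s(G,2) \le \frac{1}{2}n.$$
   Context: $G$ is written additively. A subset $A=\{a_1,\dots,a_m\}$ (with $m\ge1$) of $G$ is called $t$-independent if whenever $\lambda_1a_1+\cdots+\lambda_ma_m=0$ for integers $\lambda_i$ with $\sum|\lambda_i|\le t$, we have all $\lambda_i=0$. $s(G,t)$ denotes the largest size of a $t$-independent subset of $G$ ($0$ if there is none). -}

module Defs where

open import Level using (Level)
open import Algebra.Bundles using (AbelianGroup)
open import Data.Nat using (ℕ; suc; _≤_)
open import Data.Integer as ℤ using (ℤ; +_; -[1+_]; ∣_∣)
open import Data.Fin using (Fin)
open import Data.Product using (_×_; Σ)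
open import Data.Vec.Functional using (Vector)
import Data.Vec.Functional as V
open import Data.List as List using (List)
import Data.Nat as ℕ
open import Function.Bundles using (Inverse)
open import Function.Definitions using (Injective)
import Relation.Binary.PropositionalEquality as ≡
open import Relation.Nullary using (¬_)

module _ {c ℓ : Level} (G : AbelianGroup c ℓ) where
  open AbelianGroup G renaming (_∙_ to _+_; ε to 0#; _⁻¹ to -_)
  import Algebra.Definitions.RawMonoid rawMonoid as RM

  HasOrder : ℕ → Set (c Level.⊔ ℓ)
  HasOrder n = Inverse (≡.setoid (Fin n)) setoid

  _·_ : ℤ → Carrier → Carrier
  (+ k) · x = k RM.× x
  -[1+ k ] · x = - (suc k RM.× x)

  ℓ₁ : ∀ {m} → Vector ℤ m → ℕ
  ℓ₁ {ℕ.zero} λs = 0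
  ℓ₁ {suc m} λs = ∣ λs Data.Fin.zero ∣ ℕ.+ ℓ₁ (V.tail λs)

  IsElementaryAbelian2 : Set (c Level.⊔ ℓ)
  IsElementaryAbelian2 = ∀ x → x + x ≈ 0#

  -- A = {a_1,...,a_m} given by an injective (distinct elements) family a : Fin m → G.
  -- t-independent: every integer relation Σ λ_i a_i = 0 with Σ|λ_i| ≤ t is trivial.
  IsIndependent : ℕ → ∀ {m} → Vector Carrier m → Set ℓ
  IsIndependent t {m} a =
    ∀ (λs : Vector ℤ m) → ℓ₁ λs ≤ t →
      RM.sum (λ i → λs i · a i) ≈ 0# → ∀ i → λs i ≡.≡ + 0

  IndepSubset : ℕ → ℕ → Set (c Level.⊔ ℓ)
  IndepSubset t m = Σ (Vector Carrier m) λ a →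
    (1 ≤ m) × Injective ≡._≡_ _≈_ a × IsIndependent t a

{-# OPTIONS --safe #-}
module Submission where

-- The relations of ℓ₁-weight at most 2 are ±aᵢ, ±2aᵢ and ±aᵢ ± aⱼ, so an injective family is
-- 2-independent exactly when no two (not necessarily distinct) members sum to 0. Hence an elementary
-- abelian 2-group has no 2-independent set, and a 2-independent a together with −a consists of 2m
-- distinct elements. Conversely, picking one representative from each pair {x, −x} with x ≠ −x gives
-- a 2-independent set P with G = P ∪ −P ∪ F, where F is the set of elements with 2x = 0; if 2g ≠ 0,
-- translation by g maps F into P ∪ −P, so n ≤ 4|P|.

open import Defs hiding (_·_; ℓ₁)
import Defs
open import Level using (Level)
open import Algebra.Bundles using (AbelianGroup)
import Algebra.Properties.AbelianGroup as AbelianGroupProperties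
import Algebra.Properties.CommutativeSemigroup as CommutativeSemigroupProperties
open import Data.Nat as ℕ using (ℕ; zero; suc; z≤n; s≤s; _≤_; _*_)
import Data.Nat.Properties as ℕP
open import Data.Integer as ℤ using (ℤ; +_; -[1+_]; ∣_∣)
import Data.Integer.Properties as ℤP
open import Data.Fin as F using (Fin)
import Data.Fin.Properties as FP
open import Data.Product as Product using (_×_; Σ; ∃; _,_; proj₂)
open import Data.Sum as Sum using (_⊎_; inj₁; inj₂)
open import Data.Empty using (⊥-elim)
open import Data.Vec.Functional using (Vector; tail; updateAt)
open import Data.Vec.Functional.Properties using (updateAt-updates)
open import Data.List using (List; _∷_; length; lookup; filter; allFin; map; _++_)
open import Data.List.Properties using (length-++; length-map)
open import Data.List.Membership.Propositional using (_∈_)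
open import Data.List.Membership.Propositional.Properties
  using (∈-lookup; ∈-filter⁺; ∈-filter⁻; ∈-allFin; ∈-map⁺; ∈-++⁺ˡ; ∈-++⁺ʳ)
import Data.List.Membership.Setoid.Properties as SetoidMembership
open import Data.List.Relation.Unary.Unique.Propositional using (Unique; _∷_)
import Data.List.Relation.Unary.Unique.Propositional.Properties as Unique
open import Function.Base using (_∘_; id)
open import Function.Bundles using (Inverse)
open import Function.Definitions using (Injective)
open import Relation.Binary.Definitions using (tri<; tri≈; tri>)
open import Relation.Binary.PropositionalEquality as ≡ using (_≡_; _≢_; refl)
open import Relation.Nullary using (¬_; Dec; yes; no; contradiction)
import Relation.Nullary.Decidable as Dec

lookup-injective : ∀ {a} {A : Set a} {xs : List A} → Unique xs → Injective _≡_ _≡_ (lookup xs)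
lookup-injective {xs = x ∷ xs} _ {F.zero} {F.zero} _ = refl
lookup-injective {xs = x ∷ xs} u {F.zero} {F.suc j} x≡xsⱼ =
  contradiction (≡.subst (_∈ xs) (≡.sym x≡xsⱼ) (∈-lookup j)) (Unique.Unique[x∷xs]⇒x∉xs u)
lookup-injective {xs = x ∷ xs} u {F.suc i} {F.zero} xsᵢ≡x =
  contradiction (≡.subst (_∈ xs) xsᵢ≡x (∈-lookup i)) (Unique.Unique[x∷xs]⇒x∉xs u)
lookup-injective (_ ∷ u) {F.suc i} {F.suc j} eq = ≡.cong F.suc (lookup-injective u eq)

length-++-map : ∀ {a} {A : Set a} (f : A → A) xs → length (xs ++ map f xs) ≡ 2 * length xs
length-++-map f xs = ≡.trans (length-++ xs) (≡.cong (length xs ℕ.+_)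
  (≡.trans (length-map f xs) (≡.sym (ℕP.+-identityʳ (length xs)))))

complete⇒≤length : ∀ {n} {ys : List (Fin n)} → (∀ i → i ∈ ys) → n ≤ length ys
complete⇒≤length complete =
  FP.injective⇒≤ (SetoidMembership.index-injective (≡.setoid _) (complete _) (complete _))

module Involution {n} (σ : Fin n → Fin n) (σ-involutive : ∀ i → σ (σ i) ≡ i) where

  private
    ascends? : ∀ i → Dec (i F.< σ i)
    ascends? i = i FP.<? σ i

  lowerHalf : List (Fin n)
  lowerHalf = filter ascends? (allFin n)

  lowerHalf-unique : Unique lowerHalf
  lowerHalf-unique = Unique.filter⁺ ascends? (Unique.allFin⁺ n)

  ∈lowerHalf⇒< : ∀ {i} → i ∈ lowerHalf → i F.< σ i
  ∈lowerHalf⇒< = proj₂ ∘ ∈-filter⁻ ascends? {xs = allFin n}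

  moved : List (Fin n)
  moved = lowerHalf ++ map σ lowerHalf

  length-moved : length moved ≡ 2 * length lowerHalf
  length-moved = length-++-map σ lowerHalf

  ∈moved : ∀ i → i ≢ σ i → i ∈ moved
  ∈moved i i≢σi with FP.<-cmp i (σ i)
  ... | tri< i<σi _ _ = ∈-++⁺ˡ (∈-filter⁺ ascends? (∈-allFin i) i<σi)
  ... | tri≈ _ i≡σi _ = contradiction i≡σi i≢σi
  ... | tri> _ _ σi<i = ∈-++⁺ʳ lowerHalf (≡.subst (_∈ map σ lowerHalf) (σ-involutive i)
          (∈-map⁺ σ (∈-filter⁺ ascends? (∈-allFin (σ i)) σi<σσi)))
    where
    σi<σσi : σ i F.< σ (σ i)
    σi<σσi = ≡.subst (σ i F.<_) (≡.sym (σ-involutive i)) σi<i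

module _ {c ℓ : Level} (G : AbelianGroup c ℓ) where
  open AbelianGroup G renaming (_∙_ to _+_; ε to 0#; _⁻¹ to -_; refl to ≈-refl)
  open AbelianGroupProperties G
  open CommutativeSemigroupProperties commutativeSemigroup using (x∙yz≈y∙xz; interchange)
  open import Relation.Binary.Reasoning.Setoid setoid
  import Algebra.Definitions.RawMonoid rawMonoid as RM

  private
    _·_ : ℤ → Carrier → Carrier
    _·_ = Defs._·_ G
    ℓ₁ : ∀ {m} → Vector ℤ m → ℕ
    ℓ₁ = Defs.ℓ₁ G
    variable
      m : ℕ

  linComb : Vector ℤ m → Vector Carrier m → Carrier
  linComb λs a = RM.sum (λ i → λs i · a i)

  ℓ₁-zeros : ℓ₁ {m} (λ _ → + 0) ≡ 0
  ℓ₁-zeros {zero} = refl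
  ℓ₁-zeros {suc m} = ℓ₁-zeros {m}

  linComb-ℓ₁≤0 : ∀ (λs : Vector ℤ m) a → ℓ₁ λs ≤ 0 → linComb λs a ≈ 0#
  linComb-ℓ₁≤0 {zero} λs a _ = ≈-refl
  linComb-ℓ₁≤0 {suc m} λs a = split (λs F.zero) (tail λs)
    where
    split : ∀ z t → ∣ z ∣ ℕ.+ ℓ₁ t ≤ 0 → z · a F.zero + linComb t (tail a) ≈ 0#
    split (+ zero) t w = trans (identityˡ _) (linComb-ℓ₁≤0 t (tail a) w)

  PairSumsNonZero : Vector Carrier m → Set ℓ
  PairSumsNonZero a = ∀ i j → ¬ (a i + a j ≈ 0#)

  ℓ₁-updateAt-suc : ∀ (v : Vector ℕ m) i → ℓ₁ (+_ ∘ updateAt v i suc) ≡ suc (ℓ₁ (+_ ∘ v))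
  ℓ₁-updateAt-suc {suc m} v F.zero = refl
  ℓ₁-updateAt-suc {suc m} v (F.suc i) =
    ≡.trans (≡.cong (v F.zero ℕ.+_) (ℓ₁-updateAt-suc (tail v) i)) (ℕP.+-suc _ _)

  linComb-updateAt-suc : ∀ (v : Vector ℕ m) i a →
                         linComb (+_ ∘ updateAt v i suc) a ≈ a i + linComb (+_ ∘ v) a
  linComb-updateAt-suc {suc m} v F.zero a = assoc _ _ _
  linComb-updateAt-suc {suc m} v (F.suc i) a =
    trans (∙-cong ≈-refl (linComb-updateAt-suc (tail v) i (tail a))) (x∙yz≈y∙xz _ _ _)

  independent⇒pairSumsNonZero : ∀ {a : Vector Carrier m} → IsIndependent G 2 a → PairSumsNonZero a
  independent⇒pairSumsNonZero {m} {a} independent i j ai+aj≈0 =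
    ℕP.1+n≢0 (ℤP.+-injective (≡.trans (≡.sym (≡.cong +_ (updateAt-updates i pairCount₀)))
                                      (independent λs ℓ₁λs≤2 λs-relation i)))
    where
    pairCount₀ : Vector ℕ m
    pairCount₀ = updateAt (λ _ → 0) j suc
    -- The coefficients of aᵢ + aⱼ (that is, of 2aᵢ when i = j).
    λs : Vector ℤ m
    λs = +_ ∘ updateAt pairCount₀ i suc
    ℓ₁λs≤2 : ℓ₁ λs ≤ 2
    ℓ₁λs≤2 = ℕP.≤-reflexive (≡.trans (ℓ₁-updateAt-suc pairCount₀ i)
      (≡.cong suc (≡.trans (ℓ₁-updateAt-suc (λ _ → 0) j) (≡.cong suc (ℓ₁-zeros {m})))))
    λs-relation : linComb λs a ≈ 0#
    λs-relation = begin
      linComb λs a                                  ≈⟨ linComb-updateAt-suc pairCount₀ i a ⟩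
      a i + linComb (+_ ∘ pairCount₀) a             ≈⟨ ∙-cong ≈-refl (linComb-updateAt-suc (λ _ → 0) j a) ⟩
      a i + (a j + linComb (λ _ → + 0) a)           ≈⟨ ∙-cong ≈-refl (∙-cong ≈-refl zeros-relation) ⟩
      a i + (a j + 0#)                              ≈⟨ ∙-cong ≈-refl (identityʳ (a j)) ⟩
      a i + a j                                     ≈⟨ ai+aj≈0 ⟩
      0#                                            ∎
      where
      zeros-relation : linComb (λ _ → + 0) a ≈ 0#
      zeros-relation = linComb-ℓ₁≤0 (λ _ → + 0) a (ℕP.≤-reflexive (ℓ₁-zeros {m}))

  elementaryAbelian2⇒¬independent : IsElementaryAbelian2 G → ∀ m → ¬ IndepSubset G 2 m
  elementaryAbelian2⇒¬independent x+x≈0 (suc m) (a , _ , _ , independent) =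
    independent⇒pairSumsNonZero {a = a} independent F.zero F.zero (x+x≈0 (a F.zero))

  ·-neg : ∀ z x → (ℤ.- z) · x ≈ - (z · x)
  ·-neg (+ zero) x = sym ε⁻¹≈ε
  ·-neg (+ suc k) x = ≈-refl
  ·-neg -[1+ k ] x = sym (⁻¹-involutive _)

  linComb-neg : ∀ (λs : Vector ℤ m) a → linComb (ℤ.-_ ∘ λs) a ≈ - linComb λs a
  linComb-neg {zero} λs a = sym ε⁻¹≈ε
  linComb-neg {suc m} λs a = begin
    (ℤ.- λs F.zero) · a F.zero + linComb (ℤ.-_ ∘ tail λs) (tail a)
      ≈⟨ ∙-cong (·-neg (λs F.zero) (a F.zero)) (linComb-neg (tail λs) (tail a)) ⟩
    - (λs F.zero · a F.zero) + - linComb (tail λs) (tail a)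
      ≈⟨ ⁻¹-∙-comm _ _ ⟩
    - linComb λs a ∎

  ℓ₁-neg : ∀ (λs : Vector ℤ m) → ℓ₁ (ℤ.-_ ∘ λs) ≡ ℓ₁ λs
  ℓ₁-neg {zero} λs = refl
  ℓ₁-neg {suc m} λs = ≡.cong₂ ℕ._+_ (ℤP.∣-i∣≡∣i∣ (λs F.zero)) (ℓ₁-neg (tail λs))

  _∈±_ : Carrier → Vector Carrier m → Set ℓ
  y ∈± a = ∃ λ j → y ≈ a j ⊎ y ≈ - a j

  linComb-ℓ₁≤1 : ∀ (λs : Vector ℤ m) a → ℓ₁ λs ≤ 1 → linComb λs a ≈ 0# ⊎ linComb λs a ∈± a
  linComb-ℓ₁≤1 {zero} λs a _ = inj₁ ≈-refl
  linComb-ℓ₁≤1 {suc m} λs a = split (λs F.zero) (tail λs)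
    where
    x : Carrier
    x = a F.zero
    split : ∀ z t → ∣ z ∣ ℕ.+ ℓ₁ t ≤ 1 →
            z · x + linComb t (tail a) ≈ 0# ⊎ (z · x + linComb t (tail a)) ∈± a
    split (+ zero) t w with linComb-ℓ₁≤1 t (tail a) w
    ... | inj₁ y≈0 = inj₁ (trans (identityˡ _) y≈0)
    ... | inj₂ (j , y≈±aj) = inj₂ (F.suc j , Sum.map (trans (identityˡ _)) (trans (identityˡ _)) y≈±aj)
    split (+ 1) t (s≤s w) = inj₂ (F.zero , inj₁ (begin
      (x + 0#) + linComb t (tail a) ≈⟨ ∙-cong (identityʳ x) (linComb-ℓ₁≤0 t (tail a) w) ⟩
      x + 0#                        ≈⟨ identityʳ x ⟩
      x                             ∎))
    split -[1+ 0 ] t (s≤s w) = inj₂ (F.zero , inj₂ (begin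
      - (x + 0#) + linComb t (tail a) ≈⟨ ∙-cong (⁻¹-cong (identityʳ x)) (linComb-ℓ₁≤0 t (tail a) w) ⟩
      - x + 0#                        ≈⟨ identityʳ (- x) ⟩
      - x                             ∎))

  module _ {a : Vector Carrier (suc m)} (a-injective : Injective _≡_ _≈_ a) (sums≉0 : PairSumsNonZero a)
           where
    private
      x : Carrier
      x = a F.zero

    ¬relation-positiveHead : ∀ k t → suc k ℕ.+ ℓ₁ t ≤ 2 → ¬ ((+ suc k) · x + linComb t (tail a) ≈ 0#)
    ¬relation-positiveHead 0 t (s≤s w) rel with linComb-ℓ₁≤1 t (tail a) w
    ... | inj₁ y≈0 = sums≉0 F.zero F.zero (begin
      x + x   ≈⟨ ∙-cong x≈0 x≈0 ⟩
      0# + 0# ≈⟨ identityˡ 0# ⟩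
      0#      ∎)
      where
      x≈0 : x ≈ 0#
      x≈0 = trans (sym (trans (∙-cong (identityʳ x) y≈0) (identityʳ x))) rel
    ... | inj₂ (j , inj₁ y≈aj) = sums≉0 F.zero (F.suc j)
      (trans (sym (∙-cong (identityʳ x) y≈aj)) rel)
    ... | inj₂ (j , inj₂ y≈-aj) with a-injective (x∙y⁻¹≈ε⇒x≈y x (a (F.suc j))
      (trans (sym (∙-cong (identityʳ x) y≈-aj)) rel))
    ... | ()
    ¬relation-positiveHead 1 t (s≤s (s≤s w)) rel = sums≉0 F.zero F.zero (begin
      x + x                                   ≈⟨ ∙-cong ≈-refl (identityʳ x) ⟨
      x + (x + 0#)                            ≈⟨ identityʳ _ ⟨
      (x + (x + 0#)) + 0#                     ≈⟨ ∙-cong ≈-refl (linComb-ℓ₁≤0 t (tail a) w) ⟨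
      (x + (x + 0#)) + linComb t (tail a)     ≈⟨ rel ⟩
      0#                                      ∎)

    -- A negative head coefficient is reduced to a positive one by negating the whole relation.
    headCoefficient≡0 : ∀ z t → ∣ z ∣ ℕ.+ ℓ₁ t ≤ 2 → z · x + linComb t (tail a) ≈ 0# → z ≡ + 0
    headCoefficient≡0 (+ zero) t w rel = refl
    headCoefficient≡0 (+ suc k) t w rel = ⊥-elim (¬relation-positiveHead k t w rel)
    headCoefficient≡0 -[1+ k ] t w rel = ⊥-elim (¬relation-positiveHead k (ℤ.-_ ∘ t)
      (≡.subst (λ l → suc k ℕ.+ l ≤ 2) (≡.sym (ℓ₁-neg t)) w) (begin
      (+ suc k) · x + linComb (ℤ.-_ ∘ t) (tail a)  ≈⟨ ∙-cong (sym (⁻¹-involutive _)) (linComb-neg t (tail a)) ⟩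
      - (-[1+ k ] · x) + - linComb t (tail a)     ≈⟨ ⁻¹-∙-comm _ _ ⟩
      - (-[1+ k ] · x + linComb t (tail a))       ≈⟨ ⁻¹-cong rel ⟩
      - 0#                                        ≈⟨ ε⁻¹≈ε ⟩
      0#                                          ∎))

  pairSumsNonZero⇒independent : ∀ {a : Vector Carrier m} → Injective _≡_ _≈_ a → PairSumsNonZero a →
                                IsIndependent G 2 a
  pairSumsNonZero⇒independent {zero} _ _ _ _ _ ()
  pairSumsNonZero⇒independent {suc m} {a} a-injective sums≉0 λs w rel = λ where
      F.zero → head≡0
      (F.suc i) → pairSumsNonZero⇒independent (FP.suc-injective ∘ a-injective)
                    (λ i j → sums≉0 (F.suc i) (F.suc j)) (tail λs) (ℕP.≤-trans (ℕP.m≤n+m _ _) w) tail-rel i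
    where
    head≡0 : λs F.zero ≡ + 0
    head≡0 = headCoefficient≡0 a-injective sums≉0 (λs F.zero) (tail λs) w rel
    tail-rel : linComb (tail λs) (tail a) ≈ 0#
    tail-rel = trans (sym (identityˡ _))
      (≡.subst (λ z → z · a F.zero + linComb (tail λs) (tail a) ≈ 0#) head≡0 rel)

  module _ {n} (order : HasOrder G n) where
    open Inverse order using (to; from; to-cong; from-cong; strictlyInverseˡ; strictlyInverseʳ)

    from-injective : ∀ {x y} → from x ≡ from y → x ≈ y
    from-injective {x} {y} eq = trans (sym (strictlyInverseˡ x)) (trans (to-cong eq) (strictlyInverseˡ y))

    to-injective : ∀ {i j} → to i ≈ to j → i ≡ j
    to-injective {i} {j} eq = ≡.trans (≡.sym (strictlyInverseʳ i)) (≡.trans (from-cong eq) (strictlyInverseʳ j))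

    injective⇒≤order : ∀ {k} {f : Fin k → Carrier} → Injective _≡_ _≈_ f → k ≤ n
    injective⇒≤order f-injective = FP.injective⇒≤ (f-injective ∘ from-injective)

    independent⇒2m≤order : ∀ m → IndepSubset G 2 m → 2 * m ≤ n
    independent⇒2m≤order m (a , _ , a-injective , independent) =
      ≡.subst (_≤ n) (≡.cong (m ℕ.+_) (≡.sym (ℕP.+-identityʳ m))) (injective⇒≤order ±a-injective)
      where
      ±a : Fin (m ℕ.+ m) → Carrier
      ±a = Sum.[ a , -_ ∘ a ] ∘ F.splitAt m
      sums≉0 : PairSumsNonZero a
      sums≉0 = independent⇒pairSumsNonZero independent
      ±-injective : Injective _≡_ _≈_ Sum.[ a , -_ ∘ a ]
      ±-injective {inj₁ i} {inj₁ j} ai≈aj = ≡.cong inj₁ (a-injective ai≈aj)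
      ±-injective {inj₁ i} {inj₂ j} ai≈-aj = ⊥-elim (sums≉0 i j (trans (∙-cong ai≈-aj ≈-refl) (inverseˡ (a j))))
      ±-injective {inj₂ i} {inj₁ j} -ai≈aj = ⊥-elim (sums≉0 j i (trans (∙-cong (sym -ai≈aj) ≈-refl) (inverseˡ (a i))))
      ±-injective {inj₂ i} {inj₂ j} -ai≈-aj = ≡.cong inj₂ (a-injective (⁻¹-injective -ai≈-aj))
      ±a-injective : Injective _≡_ _≈_ ±a
      ±a-injective {k} {k′} eq = ≡.trans (≡.sym (FP.join-splitAt m m k))
        (≡.trans (≡.cong (F.join m m) (±-injective {F.splitAt m k} {F.splitAt m k′} eq))
                 (FP.join-splitAt m m k′))

    infix 4 _≈?_
    _≈?_ : ∀ x y → Dec (x ≈ y)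
    x ≈? y = Dec.map′ from-injective from-cong (from x FP.≟ from y)

    negate : Fin n → Fin n
    negate i = from (- to i)

    negate-involutive : ∀ i → negate (negate i) ≡ i
    negate-involutive i = ≡.trans
      (from-cong (trans (⁻¹-cong (strictlyInverseˡ (- to i))) (⁻¹-involutive (to i))))
      (strictlyInverseʳ i)

    ≡negate⇒x+x≈0 : ∀ {i} → i ≡ negate i → to i + to i ≈ 0#
    ≡negate⇒x+x≈0 {i} i≡-i =
      trans (∙-cong (trans (reflexive (≡.cong to i≡-i)) (strictlyInverseˡ _)) ≈-refl) (inverseˡ (to i))

    x+y≈0⇒≡negate : ∀ {i j} → to i + to j ≈ 0# → j ≡ negate i
    x+y≈0⇒≡negate {i} {j} sum≈0 = ≡.trans (≡.sym (strictlyInverseʳ j)) (from-cong (inverseʳ-unique _ _ sum≈0))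

    ¬elementaryAbelian2⇒∃x+x≉0 : ¬ IsElementaryAbelian2 G → ∃ λ g → ¬ (g + g ≈ 0#)
    ¬elementaryAbelian2⇒∃x+x≉0 ¬elementary =
      Product.map to id (FP.¬∀⟶∃¬ n (λ i → to i + to i ≈ 0#) (λ i → to i + to i ≈? 0#) ¬∀i→2i≈0)
      where
      ¬∀i→2i≈0 : ¬ (∀ i → to i + to i ≈ 0#)
      ¬∀i→2i≈0 ∀i→2i≈0 = ¬elementary λ x →
        trans (∙-cong (sym (strictlyInverseˡ x)) (sym (strictlyInverseˡ x))) (∀i→2i≈0 (from x))

    module _ {g : Carrier} (g+g≉0 : ¬ (g + g ≈ 0#)) where
      open Involution negate negate-involutive

      private
        shift unshift : Fin n → Fin n
        shift i = from (to i + g)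
        unshift i = from (to i - g)

      unshift-shift : ∀ i → unshift (shift i) ≡ i
      unshift-shift i = ≡.trans (from-cong (begin
        to (from (to i + g)) - g ≈⟨ ∙-cong (strictlyInverseˡ _) ≈-refl ⟩
        (to i + g) - g          ≈⟨ assoc _ _ _ ⟩
        to i + (g - g)          ≈⟨ ∙-cong ≈-refl (inverseʳ g) ⟩
        to i + 0#               ≈⟨ identityʳ _ ⟩
        to i                    ∎)) (strictlyInverseʳ i)

      shift-moves-fixed : ∀ i → i ≡ negate i → shift i ≢ negate (shift i)
      shift-moves-fixed i i≡-i shifted≡- = g+g≉0 (begin
        g + g                        ≈⟨ identityˡ _ ⟨
        0# + (g + g)                 ≈⟨ ∙-cong (≡negate⇒x+x≈0 i≡-i) ≈-refl ⟨
        (to i + to i) + (g + g)      ≈⟨ interchange _ _ _ _ ⟩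
        (to i + g) + (to i + g)      ≈⟨ ∙-cong shifted≈ shifted≈ ⟨
        to (shift i) + to (shift i)  ≈⟨ ≡negate⇒x+x≈0 shifted≡- ⟩
        0#                           ∎)
        where
        shifted≈ : to (shift i) ≈ to i + g
        shifted≈ = strictlyInverseˡ _

      ∈moved++unshift : ∀ i → i ∈ moved ++ map unshift moved
      ∈moved++unshift i with i FP.≟ negate i
      ... | no i≢-i = ∈-++⁺ˡ (∈moved i i≢-i)
      ... | yes i≡-i = ∈-++⁺ʳ moved (≡.subst (_∈ map unshift moved) (unshift-shift i)
              (∈-map⁺ unshift (∈moved (shift i) (shift-moves-fixed i i≡-i))))

      order≤4*|lowerHalf| : n ≤ 4 * length lowerHalf
      order≤4*|lowerHalf| = ℕP.≤-trans (complete⇒≤length ∈moved++unshift) (ℕP.≤-reflexive (≡.trans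
        (length-++-map unshift moved)
        (≡.trans (≡.cong (2 *_) length-moved) (≡.sym (ℕP.*-assoc 2 2 (length lowerHalf))))))

      lowerHalfElements : Vector Carrier (length lowerHalf)
      lowerHalfElements = to ∘ lookup lowerHalf

      lowerHalfElements-injective : Injective _≡_ _≈_ lowerHalfElements
      lowerHalfElements-injective = lookup-injective lowerHalf-unique ∘ to-injective

      lowerHalfElements-pairSums≉0 : PairSumsNonZero lowerHalfElements
      lowerHalfElements-pairSums≉0 u v sum≈0 = FP.<-asym i<j j<i
        where
        i j : Fin n
        i = lookup lowerHalf u
        j = lookup lowerHalf v
        i<j : i F.< j
        i<j = ≡.subst (i F.<_) (≡.sym (x+y≈0⇒≡negate sum≈0)) (∈lowerHalf⇒< (∈-lookup u))
        j<i : j F.< i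
        j<i = ≡.subst (j F.<_) (≡.sym (x+y≈0⇒≡negate (trans (comm _ _) sum≈0))) (∈lowerHalf⇒< (∈-lookup v))

      x+x≉0⇒largeIndependent : 2 ≤ n → Σ ℕ (λ m → IndepSubset G 2 m × n ≤ 4 * m)
      x+x≉0⇒largeIndependent 2≤n =
        length lowerHalf ,
        (lowerHalfElements , 1≤|lowerHalf| , lowerHalfElements-injective ,
         pairSumsNonZero⇒independent lowerHalfElements-injective lowerHalfElements-pairSums≉0) ,
        order≤4*|lowerHalf|
        where
        1≤|lowerHalf| : 1 ≤ length lowerHalf
        1≤|lowerHalf| = positive (ℕP.≤-trans 2≤n order≤4*|lowerHalf|)
          where
          positive : ∀ {k} → 2 ≤ 4 * k → 1 ≤ k
          positive {zero} ()
          positive {suc k} _ = s≤s z≤n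

proposition5 : {c ℓ : Level} (G : AbelianGroup c ℓ) (n : ℕ) → HasOrder G n → 2 ≤ n →
    ((IsElementaryAbelian2 G → ∀ m → ¬ IndepSubset G 2 m)
    × (¬ IsElementaryAbelian2 G →
        Σ ℕ (λ m → IndepSubset G 2 m × n ≤ 4 * m)
        × (∀ m → IndepSubset G 2 m → 2 * m ≤ n)))
proposition5 G n order 2≤n =
  elementaryAbelian2⇒¬independent G ,
  λ ¬elementary → let _ , g+g≉0 = ¬elementaryAbelian2⇒∃x+x≉0 G order ¬elementary in
    x+x≉0⇒largeIndependent G order g+g≉0 2≤n , independent⇒2m≤order G order
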